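{- Let $c\ge 2$ and $k\ge 1$ be integers with $c$ an odd prime, let $s$ be a positive integer, and let $G=\mathbb{Z}_c\times\mathbb{Z}_{ck}$. If $G$ has an $s$-spanning set of size $2$, then $G$ is $s$-regular, i.e. there exist $u,v\in\mathbb{Z}_{ck}$ such that $\{(1,u),(1,v)\}$ is an $s$-spanning set of $G$.
   Context: $\mathbb{Z}_n=\mathbb{Z}/n\mathbb{Z}$. A subset $A=\{a_1,a_2\}$ of an abelian group $G$ is an $s$-spanning set if every element of $G$ equals $\lambda_1a_1+\lambda_2a_2$ for some integers $\lambda_1,\lambda_2$ with $|\lambda_1|+|\lambda_2|\le s$ (in general, every element is a signed sum of at most $s$ elements of $A$). The group $\mathbb{Z}_c\times\mathbb{Z}_{ck}$ is called $s$-regular if it possesses an $s$-spanning set of the form $\{(1,u),(1,v)\}$ with $u,v\in\mathbb{Z}_{ck}$. -}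

module Defs where

open import Data.Nat using (ℕ; _≤_; _*_)
open import Data.Fin using (Fin; toℕ)
open import Data.Integer using (ℤ; +_; _+_; _-_; ∣_∣) renaming (_*_ to _*ℤ_)
open import Data.Integer.Divisibility using (_∣_)
open import Data.Product using (Σ; ∃; _×_; _,_; proj₁; proj₂)
open import Relation.Binary.PropositionalEquality using (_≡_; _≢_)

G : ℕ → ℕ → Set
G c k = Fin c × Fin (c * k)

⟦_⟧ : ∀ {n} → Fin n → ℤ
⟦ i ⟧ = + toℕ i

_≡[mod_]_ : ℤ → ℕ → ℤ → Set
x ≡[mod n ] y = (+ n) ∣ (x - y)

SSpanning : (c k s : ℕ) → G c k → G c k → Set
SSpanning c k s a₁ a₂ =
  (g : G c k) → Σ ℤ λ l₁ → Σ ℤ λ l₂ →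
    (∣ l₁ ∣ Data.Nat.+ ∣ l₂ ∣ ≤ s) ×
    ((l₁ *ℤ ⟦ proj₁ a₁ ⟧ + l₂ *ℤ ⟦ proj₁ a₂ ⟧) ≡[mod c ] ⟦ proj₁ g ⟧) ×
    ((l₁ *ℤ ⟦ proj₂ a₁ ⟧ + l₂ *ℤ ⟦ proj₂ a₂ ⟧) ≡[mod (c * k) ] ⟦ proj₂ g ⟧)

HasSpanningSetOfSize2 : (c k s : ℕ) → Set
HasSpanningSetOfSize2 c k s =
  Σ (G c k) λ a₁ → Σ (G c k) λ a₂ → (a₁ ≢ a₂) × SSpanning c k s a₁ a₂

SRegular : (c k s : ℕ) → Set
SRegular c k s =
  Σ (Fin (c * k)) λ u → Σ (Fin (c * k)) λ v →
    Σ (Fin c) λ one → (toℕ one ≡ 1) × (u ≢ v) × SSpanning c k s (one , u) (one , v)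

-- Write a spanning pair as a₁ = (x₁, y₁), a₂ = (x₂, y₂).  Expressing (1, 0) and (0, 1) in
-- terms of a₁, a₂ and reducing modulo c shows that the determinant D = x₁y₂ − x₂y₁ is a unit
-- modulo c.  As c is an odd prime, some sign ε = ±1 makes y₂ − εy₁ a unit modulo c as well.
-- The map (x, y) ↦ (αx + βy, y) with α = E(y₂ − εy₁), β = E(εx₁ − x₂), where DE ≡ 1, is an
-- automorphism of ℤ_c × ℤ_{ck}; it sends a₁ to (1, y₁) and a₂ to (ε, y₂), and automorphisms
-- as well as replacing a generator by its negative preserve s-spanning sets.  This yields
-- {(1, y₁), (1, εy₂)}, whose two elements differ because a spanning pair has a unit determinant.
module Submission where

open import Defs
open import Data.Nat using (ℕ; _≤_; _%_)
open import Data.Nat.Primality using (Prime)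
open import Relation.Binary.PropositionalEquality using (_≡_)

open import Data.Nat.Base as ℕ using (suc; NonZero; ≢-nonZero)
import Data.Nat.Properties as ℕₚ
import Data.Nat.Divisibility as ℕ∣
open import Data.Nat.Coprimality using (coprime-Bézout; prime⇒coprime)
open import Data.Nat.GCD using (module Bézout)
open import Data.Nat.Primality using (euclidsLemma; prime⇒irreducible; prime⇒nonZero; prime[2]; ¬prime[1])
open import Data.Integer.Base using (ℤ; +_; 0ℤ; 1ℤ; -1ℤ; _+_; _-_; -_; _*_; ∣_∣)
import Data.Integer.Properties as ℤₚ
open import Data.Integer.Divisibility.Signed
  using (_∣_; divides; _∣?_; ∣ᵤ⇒∣; ∣⇒∣ᵤ; ∣-trans; ∣m∣n⇒∣m+n; ∣m∣n⇒∣m-n; ∣m⇒∣-m; ∣n⇒∣m*n; ∣m⇒∣m*n)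
open import Data.Integer.DivMod using (_%ℕ_; _/ℕ_; n%ℕd<d; a≡a%ℕn+[a/ℕn]*n)
open import Data.Integer.Tactic.RingSolver using (solve-∀)
open import Data.Fin.Base as Fin using (Fin; fromℕ<)
open import Data.Fin.Properties using (toℕ-fromℕ<)
open import Data.Product.Base using (Σ; _×_; _,_)
open import Data.Sum.Base using (inj₁; inj₂)
open import Function.Base using (_∘_)
open import Level using (0ℓ)
open import Relation.Binary.Bundles using (Setoid)
import Relation.Binary.Reasoning.Setoid as SetoidReasoning
open import Relation.Binary.PropositionalEquality using (_≢_; refl; sym; trans; cong; subst; module ≡-Reasoning)
open import Relation.Nullary using (¬_; yes; no; contradiction)

private variable
  m n p s : ℕ
  a b e x y z x₁ y₁ x₂ y₂ x₁′ y₁′ x₂′ y₂′ γ ε : ℤ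

infix 4 _≈[_]_

-- A record rather than a synonym for divisibility, so that x and y can be inferred.
record _≈[_]_ (x : ℤ) (n : ℕ) (y : ℤ) : Set where
  constructor congruent
  field divides-difference : + n ∣ x - y

≡[mod]⇒≈ : x ≡[mod n ] y → x ≈[ n ] y
≡[mod]⇒≈ {x} {n} {y} x≡y = congruent (∣ᵤ⇒∣ {+ n} {x - y} x≡y)

≈⇒≡[mod] : x ≈[ n ] y → x ≡[mod n ] y
≈⇒≡[mod] (congruent n∣x-y) = ∣⇒∣ᵤ n∣x-y

module _ {n : ℕ} where

  ≈-reflexive : x ≡ y → x ≈[ n ] y
  ≈-reflexive {x} refl = congruent (divides 0ℤ (ℤₚ.+-inverseʳ x))

  ≈-refl : x ≈[ n ] x
  ≈-refl = ≈-reflexive refl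

  ≈-sym : x ≈[ n ] y → y ≈[ n ] x
  ≈-sym {x} {y} (congruent n∣x-y) = congruent (subst (+ n ∣_) (lemma x y) (∣m⇒∣-m n∣x-y))
    where
    lemma : ∀ x y → - (x - y) ≡ y - x
    lemma = solve-∀

  ≈-trans : x ≈[ n ] y → y ≈[ n ] z → x ≈[ n ] z
  ≈-trans {x} {y} {z} (congruent n∣x-y) (congruent n∣y-z) =
    congruent (subst (+ n ∣_) (lemma x y z) (∣m∣n⇒∣m+n n∣x-y n∣y-z))
    where
    lemma : ∀ x y z → (x - y) + (y - z) ≡ x - z
    lemma = solve-∀

  +-cong : x₁ ≈[ n ] x₂ → y₁ ≈[ n ] y₂ → x₁ + y₁ ≈[ n ] x₂ + y₂
  +-cong {x₁} {x₂} {y₁} {y₂} (congruent n∣x) (congruent n∣y) =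
    congruent (subst (+ n ∣_) (lemma x₁ x₂ y₁ y₂) (∣m∣n⇒∣m+n n∣x n∣y))
    where
    lemma : ∀ x₁ x₂ y₁ y₂ → (x₁ - x₂) + (y₁ - y₂) ≡ (x₁ + y₁) - (x₂ + y₂)
    lemma = solve-∀

  *-cong : x₁ ≈[ n ] x₂ → y₁ ≈[ n ] y₂ → x₁ * y₁ ≈[ n ] x₂ * y₂
  *-cong {x₁} {x₂} {y₁} {y₂} (congruent n∣x) (congruent n∣y) =
    congruent (subst (+ n ∣_) (lemma x₁ x₂ y₁ y₂) (∣m∣n⇒∣m+n (∣m⇒∣m*n y₁ n∣x) (∣n⇒∣m*n x₂ n∣y)))
    where
    lemma : ∀ x₁ x₂ y₁ y₂ → (x₁ - x₂) * y₁ + x₂ * (y₁ - y₂) ≡ x₁ * y₁ - x₂ * y₂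
    lemma = solve-∀

  *-congˡ : ∀ a → x ≈[ n ] y → a * x ≈[ n ] a * y
  *-congˡ a = *-cong (≈-refl {a})

  *-congʳ : ∀ a → x ≈[ n ] y → x * a ≈[ n ] y * a
  *-congʳ a x≈y = *-cong x≈y (≈-refl {a})

  -‿cong : x ≈[ n ] y → - x ≈[ n ] - y
  -‿cong {x} {y} (congruent n∣x-y) = congruent (subst (+ n ∣_) (lemma x y) (∣m⇒∣-m n∣x-y))
    where
    lemma : ∀ x y → - (x - y) ≡ - x - - y
    lemma = solve-∀

  ∣⇒≈0 : + n ∣ x → x ≈[ n ] 0ℤ
  ∣⇒≈0 {x} n∣x = congruent (subst (+ n ∣_) (sym (ℤₚ.+-identityʳ x)) n∣x)

  ≈0⇒∣ : x ≈[ n ] 0ℤ → + n ∣ x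
  ≈0⇒∣ {x} (congruent n∣x-0) = subst (+ n ∣_) (ℤₚ.+-identityʳ x) n∣x-0

≈-setoid : ℕ → Setoid 0ℓ 0ℓ
≈-setoid n = record
  { Carrier       = ℤ
  ; _≈_           = _≈[ n ]_
  ; isEquivalence = record { refl = ≈-refl ; sym = ≈-sym ; trans = ≈-trans }
  }

module ≈-Reasoning (n : ℕ) = SetoidReasoning (≈-setoid n)

≈-weaken : m ℕ∣.∣ n → x ≈[ n ] y → x ≈[ m ] y
≈-weaken {m} {n} m∣n (congruent n∣x-y) = congruent (∣-trans (∣ᵤ⇒∣ {+ m} {+ n} m∣n) n∣x-y)

∣-unit⇒≡1 : x * e ≈[ m ] 1ℤ → + m ∣ x → m ≡ 1
∣-unit⇒≡1 {x} {e} xe≈1 m∣x =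
  ℕ∣.∣1⇒≡1 (∣⇒∣ᵤ (≈0⇒∣ (≈-trans (≈-sym xe≈1) (∣⇒≈0 (∣m⇒∣m*n e m∣x)))))

%ℕ-≈ : ∀ z n .{{_ : NonZero n}} → + (z %ℕ n) ≈[ n ] z
%ℕ-≈ z n = congruent (divides (- q) (begin
  + r - z               ≡⟨ cong (λ t → + r - t) (a≡a%ℕn+[a/ℕn]*n z n) ⟩
  + r - (+ r + q * + n) ≡⟨ cancel (+ r) q (+ n) ⟩
  - q * + n             ∎))
  where
  open ≡-Reasoning
  cancel : ∀ a b c → a - (a + b * c) ≡ - b * c
  cancel = solve-∀
  r = z %ℕ n
  q = z /ℕ n

reduce : (n : ℕ) .{{_ : NonZero n}} → ℤ → Fin n
reduce n z = fromℕ< (n%ℕd<d z n)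

reduce-≈ : ∀ n .{{_ : NonZero n}} z → ⟦ reduce n z ⟧ ≈[ n ] z
reduce-≈ n z = subst (_≈[ n ] z) (cong +_ (sym (toℕ-fromℕ< (n%ℕd<d z n)))) (%ℕ-≈ z n)

bézout⇒inverse : ∀ {r} → Bézout.Identity 1 m r → Σ ℤ λ γ → + r * γ ≈[ m ] 1ℤ
bézout⇒inverse {m} {r} (Bézout.+- x y 1+yr≡xm) = - + y , congruent (divides (- + x) (begin
  + r * - + y - 1ℤ    ≡⟨ rearrange (+ r) (+ y) ⟩
  - (1ℤ + + y * + r)  ≡⟨ cong (λ t → - (1ℤ + t)) (sym (ℤₚ.pos-* y r)) ⟩
  - + (1 ℕ.+ y ℕ.* r) ≡⟨ cong (-_ ∘ +_) 1+yr≡xm ⟩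
  - + (x ℕ.* m)       ≡⟨ cong -_ (ℤₚ.pos-* x m) ⟩
  - (+ x * + m)       ≡⟨ ℤₚ.neg-distribˡ-* (+ x) (+ m) ⟩
  - + x * + m         ∎))
  where
  open ≡-Reasoning
  rearrange : ∀ a b → a * - b - 1ℤ ≡ - (1ℤ + b * a)
  rearrange = solve-∀
bézout⇒inverse {m} {r} (Bézout.-+ x y 1+xm≡yr) = + y , congruent (divides (+ x) (begin
  + r * + y - 1ℤ            ≡⟨ cong (_- 1ℤ) (ℤₚ.*-comm (+ r) (+ y)) ⟩
  + y * + r - 1ℤ            ≡⟨ cong (λ t → t - 1ℤ) (sym (ℤₚ.pos-* y r)) ⟩
  + (y ℕ.* r) - 1ℤ          ≡⟨ cong (λ t → + t - 1ℤ) (sym 1+xm≡yr) ⟩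
  1ℤ + + (x ℕ.* m) - 1ℤ     ≡⟨ cong (λ t → 1ℤ + t - 1ℤ) (ℤₚ.pos-* x m) ⟩
  1ℤ + + x * + m - 1ℤ       ≡⟨ cancel (+ x * + m) ⟩
  + x * + m                 ∎))
  where
  open ≡-Reasoning
  cancel : ∀ a → 1ℤ + a - 1ℤ ≡ a
  cancel = solve-∀

inverse-mod-prime : Prime p → ¬ (+ p ∣ z) → Σ ℤ λ γ → z * γ ≈[ p ] 1ℤ
inverse-mod-prime {p} {z} p-prime p∤z =
  let γ , rγ≈1 = bézout⇒inverse (coprime-Bézout (prime⇒coprime p-prime {{≢-nonZero r≢0}} (n%ℕd<d z p)))
  in γ , ≈-trans (*-congʳ γ (≈-sym r≈z)) rγ≈1
  where
  instance
    p≢0 : NonZero p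
    p≢0 = prime⇒nonZero p-prime
  r≈z : + (z %ℕ p) ≈[ p ] z
  r≈z = %ℕ-≈ z p
  r≢0 : z %ℕ p ≢ 0
  r≢0 r≡0 = p∤z (≈0⇒∣ (≈-trans (≈-sym r≈z) (≈-reflexive (cong +_ r≡0))))

-- p divides (a + b) + (a − b) = 2a, and p ∤ 2 because the only divisors of 2 are 1 and 2.
∣a+b∧∣a-b⇒∣a∧∣b : Prime p → p ≢ 2 → + p ∣ a + b → + p ∣ a - b → (+ p ∣ a) × (+ p ∣ b)
∣a+b∧∣a-b⇒∣a∧∣b {p} {a} {b} p-prime p≢2 p∣a+b p∣a-b =
  p∣a , subst (+ p ∣_) (a-[a-b]≡b a b) (∣m∣n⇒∣m-n p∣a p∣a-b)
  where
  sum≡2a : ∀ a b → (a + b) + (a - b) ≡ + 2 * a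
  sum≡2a = solve-∀
  a-[a-b]≡b : ∀ a b → a - (a - b) ≡ b
  a-[a-b]≡b = solve-∀
  p∣2∣a∣ : p ℕ∣.∣ 2 ℕ.* ∣ a ∣
  p∣2∣a∣ = subst (p ℕ∣.∣_) (ℤₚ.abs-* (+ 2) a)
             (∣⇒∣ᵤ (subst (+ p ∣_) (sum≡2a a b) (∣m∣n⇒∣m+n p∣a+b p∣a-b)))
  p∣a : + p ∣ a
  p∣a with euclidsLemma 2 ∣ a ∣ p-prime p∣2∣a∣
  ... | inj₂ p∣∣a∣ = ∣ᵤ⇒∣ p∣∣a∣
  ... | inj₁ p∣2 with prime⇒irreducible prime[2] p∣2
  ...   | inj₁ refl = contradiction p-prime ¬prime[1]
  ...   | inj₂ p≡2 = contradiction p≡2 p≢2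

choose-sign : Prime p → p ≢ 2 → ¬ ((+ p ∣ y₁) × (+ p ∣ y₂)) →
              Σ ℤ λ ε → ε * ε ≡ 1ℤ × ¬ (+ p ∣ y₂ - ε * y₁)
choose-sign {p} {y₁} {y₂} p-prime p≢2 ¬p∣y₁,y₂ with + p ∣? y₂ - y₁
... | no p∤y₂-y₁ = 1ℤ , refl , p∤y₂-y₁ ∘ subst (+ p ∣_) (cong (λ t → y₂ - t) (ℤₚ.*-identityˡ y₁))
... | yes p∣y₂-y₁ = -1ℤ , refl , λ p∣y₂+y₁ →
  let p∣y₂ , p∣y₁ = ∣a+b∧∣a-b⇒∣a∧∣b p-prime p≢2 (subst (+ p ∣_) (minus-neg y₂ y₁) p∣y₂+y₁) p∣y₂-y₁
  in ¬p∣y₁,y₂ (p∣y₁ , p∣y₂)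
  where
  minus-neg : ∀ a b → a - -1ℤ * b ≡ a + b
  minus-neg = solve-∀

-- SSpanning, with generators and targets given by arbitrary integer representatives.
record ShortCombination (m n s : ℕ) (x₁ y₁ x₂ y₂ g₁ g₂ : ℤ) : Set where
  constructor combination
  field
    l₁ l₂   : ℤ
    bounded : ∣ l₁ ∣ ℕ.+ ∣ l₂ ∣ ≤ s
    first   : l₁ * x₁ + l₂ * x₂ ≈[ m ] g₁
    second  : l₁ * y₁ + l₂ * y₂ ≈[ n ] g₂

Spanning : (m n s : ℕ) (x₁ y₁ x₂ y₂ : ℤ) → Set
Spanning m n s x₁ y₁ x₂ y₂ = ∀ g₁ g₂ → ShortCombination m n s x₁ y₁ x₂ y₂ g₁ g₂

sspanning⇒spanning : ∀ {c k s X₁ Y₁ X₂ Y₂} .{{_ : NonZero c}} .{{_ : NonZero (c ℕ.* k)}} →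
  SSpanning c k s (X₁ , Y₁) (X₂ , Y₂) → Spanning c (c ℕ.* k) s ⟦ X₁ ⟧ ⟦ Y₁ ⟧ ⟦ X₂ ⟧ ⟦ Y₂ ⟧
sspanning⇒spanning {c} {k} sp g₁ g₂ =
  let l₁ , l₂ , bounded , first , second = sp (reduce c g₁ , reduce (c ℕ.* k) g₂)
  in combination l₁ l₂ bounded (≈-trans (≡[mod]⇒≈ first) (reduce-≈ c g₁))
                               (≈-trans (≡[mod]⇒≈ second) (reduce-≈ (c ℕ.* k) g₂))

spanning⇒sspanning : ∀ {c k s X₁ Y₁ X₂ Y₂} →
  Spanning c (c ℕ.* k) s ⟦ X₁ ⟧ ⟦ Y₁ ⟧ ⟦ X₂ ⟧ ⟦ Y₂ ⟧ → SSpanning c k s (X₁ , Y₁) (X₂ , Y₂)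
spanning⇒sspanning sp (G₁ , G₂) =
  let combination l₁ l₂ bounded first second = sp ⟦ G₁ ⟧ ⟦ G₂ ⟧
  in l₁ , l₂ , bounded , ≈⇒≡[mod] first , ≈⇒≡[mod] second

spanning-resp-≈ : x₁ ≈[ m ] x₁′ → y₁ ≈[ n ] y₁′ → x₂ ≈[ m ] x₂′ → y₂ ≈[ n ] y₂′ →
  Spanning m n s x₁ y₁ x₂ y₂ → Spanning m n s x₁′ y₁′ x₂′ y₂′
spanning-resp-≈ x₁≈ y₁≈ x₂≈ y₂≈ sp g₁ g₂ =
  let combination l₁ l₂ bounded first second = sp g₁ g₂
  in combination l₁ l₂ bounded
       (≈-trans (+-cong (*-congˡ l₁ (≈-sym x₁≈)) (*-congˡ l₂ (≈-sym x₂≈))) first)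
       (≈-trans (+-cong (*-congˡ l₁ (≈-sym y₁≈)) (*-congˡ l₂ (≈-sym y₂≈))) second)

det : ℤ → ℤ → ℤ → ℤ → ℤ
det x₁ y₁ x₂ y₂ = x₁ * y₂ - x₂ * y₁

det-product : ∀ x₁ y₁ x₂ y₂ p₁ p₂ q₁ q₂ →
  (x₁ * y₂ - x₂ * y₁) * (p₁ * q₂ - p₂ * q₁)
    ≡ (p₁ * x₁ + p₂ * x₂) * (q₁ * y₁ + q₂ * y₂) - (q₁ * x₁ + q₂ * x₂) * (p₁ * y₁ + p₂ * y₂)
det-product = solve-∀

-- The coefficients of (1, 0) and (0, 1) form a matrix inverse to the generator matrix modulo m.
spanning⇒det-invertible : m ℕ∣.∣ n → Spanning m n s x₁ y₁ x₂ y₂ →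
  Σ ℤ λ e → det x₁ y₁ x₂ y₂ * e ≈[ m ] 1ℤ
spanning⇒det-invertible {m} {x₁ = x₁} {y₁} {x₂} {y₂} m∣n sp =
  let combination p₁ p₂ _ p-first p-second = sp 1ℤ 0ℤ
      combination q₁ q₂ _ q-first q-second = sp 0ℤ 1ℤ
  in p₁ * q₂ - p₂ * q₁ , (begin
      det x₁ y₁ x₂ y₂ * (p₁ * q₂ - p₂ * q₁)
        ≡⟨ det-product x₁ y₁ x₂ y₂ p₁ p₂ q₁ q₂ ⟩
      (p₁ * x₁ + p₂ * x₂) * (q₁ * y₁ + q₂ * y₂) - (q₁ * x₁ + q₂ * x₂) * (p₁ * y₁ + p₂ * y₂)
        ≈⟨ +-cong (*-cong p-first (≈-weaken m∣n q-second))
                  (-‿cong (*-cong q-first (≈-weaken m∣n p-second))) ⟩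
      1ℤ * 1ℤ - 0ℤ * 0ℤ
        ∎)
  where open ≈-Reasoning m

spanning-repeated⇒≡1 : m ℕ∣.∣ n → Spanning m n s x y x y → m ≡ 1
spanning-repeated⇒≡1 {x = x} {y} m∣n sp =
  let e , De≈1 = spanning⇒det-invertible m∣n sp
  in ∣-unit⇒≡1 De≈1 (divides 0ℤ (ℤₚ.+-inverseʳ (x * y)))

spanning-scaleʳ : ε * ε ≡ 1ℤ → Spanning m n s x₁ y₁ x₂ y₂ → Spanning m n s x₁ y₁ (ε * x₂) (ε * y₂)
spanning-scaleʳ {ε} {s = s} {x₁} {y₁} {x₂} {y₂} ε²≡1 sp g₁ g₂ =
  let combination l₁ l₂ bounded first second = sp g₁ g₂
  in combination l₁ (ε * l₂) (subst (λ t → ∣ l₁ ∣ ℕ.+ t ≤ s) (sym (∣ε*l∣≡∣l∣ l₂)) bounded)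
       (≈-trans (≈-reflexive (cancel l₁ l₂ x₁ x₂)) first)
       (≈-trans (≈-reflexive (cancel l₁ l₂ y₁ y₂)) second)
  where
  open ≡-Reasoning
  ∣ε∣≡1 : ∣ ε ∣ ≡ 1
  ∣ε∣≡1 = ℕₚ.m*n≡1⇒n≡1 ∣ ε ∣ ∣ ε ∣ (trans (sym (ℤₚ.abs-* ε ε)) (cong ∣_∣ ε²≡1))
  ∣ε*l∣≡∣l∣ : ∀ l → ∣ ε * l ∣ ≡ ∣ l ∣
  ∣ε*l∣≡∣l∣ l = trans (ℤₚ.abs-* ε l) (trans (cong (ℕ._* ∣ l ∣) ∣ε∣≡1) (ℕₚ.*-identityˡ ∣ l ∣))
  regroup : ∀ l₁ l₂ t₁ t₂ ε → l₁ * t₁ + ε * l₂ * (ε * t₂) ≡ l₁ * t₁ + ε * ε * (l₂ * t₂)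
  regroup = solve-∀
  cancel : ∀ l₁ l₂ t₁ t₂ → l₁ * t₁ + ε * l₂ * (ε * t₂) ≡ l₁ * t₁ + l₂ * t₂
  cancel l₁ l₂ t₁ t₂ = begin
    l₁ * t₁ + ε * l₂ * (ε * t₂)       ≡⟨ regroup l₁ l₂ t₁ t₂ ε ⟩
    l₁ * t₁ + ε * ε * (l₂ * t₂)       ≡⟨ cong (λ u → l₁ * t₁ + u * (l₂ * t₂)) ε²≡1 ⟩
    l₁ * t₁ + 1ℤ * (l₂ * t₂)          ≡⟨ cong (λ u → l₁ * t₁ + u) (ℤₚ.*-identityˡ (l₂ * t₂)) ⟩
    l₁ * t₁ + l₂ * t₂                 ∎

-- (x, y) ↦ (αx + βy, y) is an automorphism of ℤ_m × ℤ_n when m ∣ n and α is a unit modulo m.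
spanning-shear : ∀ {α β ι} → m ℕ∣.∣ n → α * ι ≈[ m ] 1ℤ → Spanning m n s x₁ y₁ x₂ y₂ →
  Spanning m n s (α * x₁ + β * y₁) y₁ (α * x₂ + β * y₂) y₂
spanning-shear {m} {x₁ = x₁} {y₁} {x₂} {y₂} {α} {β} {ι} m∣n αι≈1 sp g₁ g₂ =
  let combination l₁ l₂ bounded first second = sp (ι * (g₁ - β * g₂)) g₂
  in combination l₁ l₂ bounded (begin
       l₁ * (α * x₁ + β * y₁) + l₂ * (α * x₂ + β * y₂)
         ≡⟨ regroup l₁ l₂ α β x₁ y₁ x₂ y₂ ⟩
       α * (l₁ * x₁ + l₂ * x₂) + β * (l₁ * y₁ + l₂ * y₂)
         ≈⟨ +-cong (*-congˡ α first) (*-congˡ β (≈-weaken m∣n second)) ⟩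
       α * (ι * (g₁ - β * g₂)) + β * g₂
         ≡⟨ cong (_+ β * g₂) (sym (ℤₚ.*-assoc α ι (g₁ - β * g₂))) ⟩
       α * ι * (g₁ - β * g₂) + β * g₂
         ≈⟨ +-cong (*-congʳ (g₁ - β * g₂) αι≈1) ≈-refl ⟩
       1ℤ * (g₁ - β * g₂) + β * g₂
         ≡⟨ cancel β g₁ g₂ ⟩
       g₁ ∎) second
  where
  open ≈-Reasoning m
  regroup : ∀ l₁ l₂ α β x₁ y₁ x₂ y₂ →
    l₁ * (α * x₁ + β * y₁) + l₂ * (α * x₂ + β * y₂) ≡ α * (l₁ * x₁ + l₂ * x₂) + β * (l₁ * y₁ + l₂ * y₂)
  regroup = solve-∀
  cancel : ∀ β g₁ g₂ → 1ℤ * (g₁ - β * g₂) + β * g₂ ≡ g₁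
  cancel = solve-∀

spanning-normalise : m ℕ∣.∣ n → det x₁ y₁ x₂ y₂ * e ≈[ m ] 1ℤ → ε * ε ≡ 1ℤ →
  (y₂ - ε * y₁) * γ ≈[ m ] 1ℤ → Spanning m n s x₁ y₁ x₂ y₂ → Spanning m n s 1ℤ y₁ 1ℤ (ε * y₂)
spanning-normalise {m} {x₁ = x₁} {y₁} {x₂} {y₂} {e} {ε} {γ} m∣n De≈1 ε²≡1 wγ≈1 sp =
  spanning-resp-≈ sheared₁≈1 ≈-refl sheared₂≈1 ≈-refl
    (spanning-scaleʳ {ε = ε} ε²≡1 (spanning-shear {α = α} {β = β} m∣n αι≈1 sp))
  where
  open ≈-Reasoning m
  D = det x₁ y₁ x₂ y₂
  α = e * (y₂ - ε * y₁)
  β = e * (ε * x₁ - x₂)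
  swap-middle : ∀ a b c d → a * b * (c * d) ≡ c * a * (b * d)
  swap-middle = solve-∀
  sheared₁ : ∀ e ε x₁ y₁ x₂ y₂ →
    e * (y₂ - ε * y₁) * x₁ + e * (ε * x₁ - x₂) * y₁ ≡ (x₁ * y₂ - x₂ * y₁) * e
  sheared₁ = solve-∀
  sheared₂ : ∀ e ε x₁ y₁ x₂ y₂ →
    ε * (e * (y₂ - ε * y₁) * x₂ + e * (ε * x₁ - x₂) * y₂) ≡ ε * ε * ((x₁ * y₂ - x₂ * y₁) * e)
  sheared₂ = solve-∀
  αι≈1 : α * (D * γ) ≈[ m ] 1ℤ
  αι≈1 = begin
    e * (y₂ - ε * y₁) * (D * γ) ≡⟨ swap-middle e (y₂ - ε * y₁) D γ ⟩
    D * e * ((y₂ - ε * y₁) * γ) ≈⟨ *-cong De≈1 wγ≈1 ⟩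
    1ℤ * 1ℤ                     ∎
  sheared₁≈1 : α * x₁ + β * y₁ ≈[ m ] 1ℤ
  sheared₁≈1 = ≈-trans (≈-reflexive (sheared₁ e ε x₁ y₁ x₂ y₂)) De≈1
  sheared₂≈1 : ε * (α * x₂ + β * y₂) ≈[ m ] 1ℤ
  sheared₂≈1 = begin
    ε * (α * x₂ + β * y₂) ≡⟨ sheared₂ e ε x₁ y₁ x₂ y₂ ⟩
    ε * ε * (D * e)       ≈⟨ *-cong (≈-reflexive ε²≡1) De≈1 ⟩
    1ℤ * 1ℤ               ∎

spanning⇒regular : Prime p → p ≢ 2 → p ℕ∣.∣ n → Spanning p n s x₁ y₁ x₂ y₂ →
  Σ ℤ λ ε → Spanning p n s 1ℤ y₁ 1ℤ (ε * y₂)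
spanning⇒regular {x₁ = x₁} {x₂ = x₂} p-prime p≢2 p∣n sp =
  let e , De≈1 = spanning⇒det-invertible p∣n sp
      ε , ε²≡1 , p∤w = choose-sign p-prime p≢2 λ (p∣y₁ , p∣y₂) →
        ¬prime[1] (subst Prime (∣-unit⇒≡1 De≈1 (∣m∣n⇒∣m-n (∣n⇒∣m*n x₁ p∣y₂) (∣n⇒∣m*n x₂ p∣y₁))) p-prime)
      γ , wγ≈1 = inverse-mod-prime p-prime p∤w
  in ε , spanning-normalise {ε = ε} {γ = γ} p∣n De≈1 ε²≡1 wγ≈1 sp

spanning⇒sregular : ∀ {c′ k′ s} (u : Fin (suc (suc c′) ℕ.* suc k′)) w →
  Spanning (suc (suc c′)) (suc (suc c′) ℕ.* suc k′) s 1ℤ ⟦ u ⟧ 1ℤ w → SRegular (suc (suc c′)) (suc k′) s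
spanning⇒sregular {c′} {k′} {s} u w sp =
  u , v , Fin.suc Fin.zero , refl , u≢v , spanning⇒sspanning {k = suc k′} sp′
  where
  ck = suc (suc c′) ℕ.* suc k′
  v = reduce ck w
  sp′ : Spanning (suc (suc c′)) ck s 1ℤ ⟦ u ⟧ 1ℤ ⟦ v ⟧
  sp′ = spanning-resp-≈ ≈-refl ≈-refl ≈-refl (≈-sym (reduce-≈ ck w)) sp
  u≢v : u ≢ v
  u≢v u≡v = contradiction (spanning-repeated⇒≡1 (ℕ∣.m∣m*n (suc k′))
              (subst (λ t → Spanning (suc (suc c′)) ck s 1ℤ ⟦ t ⟧ 1ℤ ⟦ v ⟧) u≡v sp′)) λ ()

odd⇒≢2 : n % 2 ≡ 1 → n ≢ 2
odd⇒≢2 () refl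

mainTheorem8 : (c k s : ℕ) → 2 ≤ c → Prime c → c % 2 ≡ 1 → 1 ≤ k → 1 ≤ s →
    HasSpanningSetOfSize2 c k s → SRegular c k s
mainTheorem8 (suc (suc _)) (suc k) s _ c-prime c-odd _ _ ((X₁ , Y₁) , (X₂ , Y₂) , _ , a-spanning) =
  let ε , regular = spanning⇒regular c-prime (odd⇒≢2 c-odd) (ℕ∣.m∣m*n (suc k))
                      (sspanning⇒spanning {k = suc k} a-spanning)
  in spanning⇒sregular Y₁ (ε * ⟦ Y₂ ⟧) regular
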